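{- Let $p$ be an odd prime and let $\ell$ be the multiplicative order of $2$ modulo $p$. Then \[ f_2(p)\le\begin{cases}\frac14(p+1)(p-1)\bigl(1+\frac1\ell\bigr)+1 & \text{if } \ell \text{ is odd},\\[1ex] \frac14(p+1)(p-1)\bigl(1+\frac2\ell\bigr)+1 & \text{if } \ell\equiv 2 \pmod 4,\\[1ex] \frac14(p+1)(p-1)+1 & \text{if } \ell\equiv 0\pmod 4.\end{cases} \]
   Context: An $n$-ary $k$-radius sequence is a finite sequence $a_0,\ldots,a_{m-1}$ of elements of $\{0,\ldots,n-1\}$ such that for all distinct $x,y$ in this set there exist $i,j$ with $a_i=x$, $a_j=y$, $|i-j|\le k$; $f_k(n)$ is the shortest length of such a sequence. -}

module Defs where

open import Data.Nat using (ℕ; zero; suc; _+_; _*_; _∸_; _^_; _≤_; _<_; NonZero)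
open import Data.Nat.DivMod using (_%_)
open import Data.Fin using (Fin; fromℕ<)
open import Data.List using (List; length; lookup)
open import Data.Product using (Σ; ∃; _×_; _,_)
open import Relation.Binary.PropositionalEquality using (_≡_; _≢_)

∣_-_∣ : ℕ → ℕ → ℕ
∣ zero - j ∣ = j
∣ suc i - zero ∣ = suc i
∣ suc i - suc j ∣ = ∣ i - j ∣

IsRadiusSeq : (n k : ℕ) → List (Fin n) → Set
IsRadiusSeq n k a =
  (x y : Fin n) → x ≢ y →
  Σ ℕ λ i → Σ ℕ λ j → Σ (i < length a) λ i< → Σ (j < length a) λ j< →
    (lookup a (fromℕ< i<) ≡ x) × (lookup a (fromℕ< j<) ≡ y) × (∣ i - j ∣ ≤ k)

-- f_k(n) ≤ B : the shortest length of an n-ary k-radius sequence is at most B,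
-- i.e. some n-ary k-radius sequence has length at most B.
fLe : (k n B : ℕ) → Set
fLe k n B = Σ (List (Fin n)) λ a → IsRadiusSeq n k a × (length a ≤ B)

IsMultOrder : (a p : ℕ) .{{_ : NonZero p}} → ℕ → Set
IsMultOrder a p ℓ =
  (1 ≤ ℓ) × ((a ^ ℓ) % p ≡ 1 % p) × ((m : ℕ) → 1 ≤ m → (a ^ m) % p ≡ 1 % p → ℓ ≤ m)

module Submission where

open import Data.Bool using (Bool; true; false; _xor_)
open import Data.Empty using (⊥; ⊥-elim)
open import Data.Fin using (Fin; toℕ; fromℕ<; remQuot; combine)
open import Data.Fin.Properties using (toℕ-fromℕ<; toℕ<n; toℕ-injective; all?; ¬∀⟶∃¬; combine-remQuot; injective⇒≤)
open import Data.List using (List; []; _∷_; _++_; length; lookup; map; filter; upTo; cartesianProductWith)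
open import Data.List.Membership.Propositional using (_∈_)
open import Data.List.Membership.Propositional.Properties using (∈-lookup; ∈-filter⁺; ∈-filter⁻; ∈-upTo⁺; ∈-cartesianProductWith⁺)
open import Data.List.Properties using (length-++; length-map; length-upTo)
open import Data.List.Relation.Unary.All as All using ()
open import Data.List.Relation.Unary.Any using (here; there)
open import Data.List.Relation.Unary.Unique.Propositional using (Unique; _∷_)
open import Data.List.Relation.Unary.Unique.Propositional.Properties using (upTo⁺; filter⁺)
open import Data.Nat using (ℕ; zero; suc; _+_; _*_; _∸_; _^_; _≤_; _<_; z≤n; s≤s; s≤s⁻¹; NonZero; _≤?_; _<?_; >-nonZero)
open import Data.Nat.DivMod using (_%_; _/_; m≡m%n+[m/n]*n; m%n%n≡m%n; m*n%n≡0; m%n<n; m<n⇒m%n≡m; n%n≡0; %-distribˡ-+; %-distribˡ-*)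
open import Data.Nat.Divisibility using (_∣_; m%n≡0⇒n∣m; n∣m⇒m%n≡0; >⇒∤)
open import Data.Nat.Coprimality using (prime⇒coprime; coprime-Bézout)
open import Data.Nat.GCD using (module Bézout)
open import Data.Nat.Induction using (<-rec)
open import Data.Nat.Primality using (Prime; euclidsLemma; ¬prime[0]; ¬prime[1])
open import Data.Nat.Properties
open import Data.Nat.Tactic.RingSolver using (solve-∀)
open import Data.Product using (Σ; _×_; _,_; proj₁; proj₂; uncurry)
open import Data.Sum using (_⊎_; inj₁; inj₂)
open import Level using (0ℓ)
open import Relation.Binary using (IsEquivalence; Setoid)
open import Relation.Binary.Definitions using (tri<; tri≈; tri>)
open import Relation.Binary.PropositionalEquality
import Relation.Binary.Reasoning.Setoid as SetoidReasoning
open import Relation.Nullary using (¬_; Dec; yes; no)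
open import Relation.Nullary.Decidable using (_×-dec_)

open import Defs

-- For a list ds of differences, chain (q + 2) 0 ds runs through
-- the arithmetic progressions a, d + a, …, (q + 1)d + a modulo p, one for each
-- d ∈ ds, each starting where the previous one stopped.  For a unit d such a
-- window contains every residue x, followed one and two steps later by x + d and
-- x + 2d.  Hence if every nonzero residue is ±d or ±2d for some d ∈ ds, the chain
-- is a 2-radius sequence of length 1 + |ds|(q + 2)  (chain-radius).
--
-- Take h = -2, L = ℓ if ℓ is odd and h = 2, L = ℓ/2 if ℓ is even.
-- Then h ^ L ≈ -1 and h has order 2L, so the nonzero residues fall into N orbits
-- under multiplication by h, each of size 2L, and N·2L ≤ q  (Orbits).  Every
-- element of the orbit of a representative c is ±h ^ f · c with f < L, that is
-- ±t · h ^ (2j) · c with t ∈ {1, 2} and 2j ≤ f.  So the N·K differences h ^ (2j) · c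
-- with j < K = ⌈L/2⌉ suffice  (Covering), and the length 1 + N·K·(q + 2) yields
-- the three bounds  (length-estimate, OrderOfTwo).

parity : ∀ f → Σ ℕ λ j → (f ≡ 2 * j) ⊎ (f ≡ suc (2 * j))
parity zero          = 0 , inj₁ refl
parity (suc zero)    = 0 , inj₂ refl
parity (suc (suc f)) with parity f
... | j , inj₁ eq = suc j , inj₁ (trans (cong (λ m → suc (suc m)) eq) (cong suc (sym (+-suc j (j + 0)))))
... | j , inj₂ eq = suc j , inj₂ (trans (cong (λ m → suc (suc m)) eq) (cong (λ m → suc (suc m)) (sym (+-suc j (j + 0)))))

odd≤next-even : ∀ j → suc (2 * j) ≤ 2 * suc j
odd≤next-even j = subst (suc (2 * j) ≤_) (sym (*-suc 2 j)) (n≤1+n _)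

∸-below-double : ∀ {e L} → L ≤ e → e < 2 * L → e ∸ L < L
∸-below-double {e} {L} L≤e e<2L =
  subst (e ∸ L <_) (trans (m+n∸m≡n L (L + 0)) (+-identityʳ L)) (∸-monoˡ-< e<2L L≤e)

^-distribʳ-* : ∀ x y k → (x * y) ^ k ≡ x ^ k * y ^ k
^-distribʳ-* x y zero    = refl
^-distribʳ-* x y (suc k) = begin
  x * y * (x * y) ^ k      ≡⟨ cong (x * y *_) (^-distribʳ-* x y k) ⟩
  x * y * (x ^ k * y ^ k)  ≡⟨ regroup x y (x ^ k) (y ^ k) ⟩
  x * x ^ k * (y * y ^ k)  ∎
  where
  open ≡-Reasoning
  regroup : ∀ a b c d → a * b * (c * d) ≡ a * c * (b * d)
  regroup = solve-∀

^-double : ∀ x d → x ^ (2 * d) ≡ x ^ d * x ^ d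
^-double x d = trans (cong (λ e → x ^ (d + e)) (+-identityʳ d)) (^-distribˡ-+-* x d d)

length-estimate : ∀ N K L q x y → N * (2 * L) ≤ q → 4 * K * x ≤ 2 * L * y →
                  4 * x * suc (N * K * (q + 2)) ≤ (suc q + 1) * q * y + 4 * x
length-estimate N K L q x y orbits≤q 4Kx≤2Ly = begin
  4 * x * suc (N * K * (q + 2))          ≡⟨ expand N K q x ⟩
  4 * x + N * (q + 2) * (4 * K * x)      ≤⟨ +-monoʳ-≤ (4 * x) (*-monoʳ-≤ (N * (q + 2)) 4Kx≤2Ly) ⟩
  4 * x + N * (q + 2) * (2 * L * y)      ≡⟨ regroup N L q x y ⟩
  4 * x + N * (2 * L) * ((q + 2) * y)    ≤⟨ +-monoʳ-≤ (4 * x) (*-monoˡ-≤ ((q + 2) * y) orbits≤q) ⟩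
  4 * x + q * ((q + 2) * y)              ≡⟨ collect q x y ⟩
  (suc q + 1) * q * y + 4 * x            ∎
  where
  open ≤-Reasoning
  expand : ∀ N K q x → 4 * x * suc (N * K * (q + 2)) ≡ 4 * x + N * (q + 2) * (4 * K * x)
  expand = solve-∀
  regroup : ∀ N L q x y → 4 * x + N * (q + 2) * (2 * L * y) ≡ 4 * x + N * (2 * L) * ((q + 2) * y)
  regroup = solve-∀
  collect : ∀ q x y → 4 * x + q * ((q + 2) * y) ≡ (suc q + 1) * q * y + 4 * x
  collect = solve-∀

infix 4 _[_]=_
data _[_]=_ {A : Set} : List A → ℕ → A → Set where
  here  : ∀ {x xs} → (x ∷ xs) [ 0 ]= x
  there : ∀ {x xs i y} → xs [ i ]= y → (x ∷ xs) [ suc i ]= y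

[]=⇒lookup : ∀ {A : Set} {xs : List A} {i y} → xs [ i ]= y →
             Σ (i < length xs) λ i< → lookup xs (fromℕ< i<) ≡ y
[]=⇒lookup here = s≤s z≤n , refl
[]=⇒lookup (there p) with i< , eq ← []=⇒lookup p = s≤s i< , eq

[]=-map : ∀ {A B : Set} (f : A → B) {xs i y} → xs [ i ]= y → map f xs [ i ]= f y
[]=-map f here      = here
[]=-map f (there p) = there ([]=-map f p)

[]=-++ʳ : ∀ {A : Set} (xs : List A) {ys i y} → ys [ i ]= y → (xs ++ ys) [ length xs + i ]= y
[]=-++ʳ []       p = p
[]=-++ʳ (x ∷ xs) p = there ([]=-++ʳ xs p)

lookup-injective : ∀ {A : Set} {xs : List A} → Unique xs →
                   ∀ i j → lookup xs i ≡ lookup xs j → i ≡ j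
lookup-injective (x∉ ∷ u) Fin.zero    Fin.zero    _  = refl
lookup-injective (x∉ ∷ u) Fin.zero    (Fin.suc j) eq = ⊥-elim (All.lookup x∉ (∈-lookup j) eq)
lookup-injective (x∉ ∷ u) (Fin.suc i) Fin.zero    eq = ⊥-elim (All.lookup x∉ (∈-lookup i) (sym eq))
lookup-injective (x∉ ∷ u) (Fin.suc i) (Fin.suc j) eq = cong Fin.suc (lookup-injective u i j eq)

length-cartesianProductWith : ∀ {A B C : Set} (f : A → B → C) xs ys →
  length (cartesianProductWith f xs ys) ≡ length xs * length ys
length-cartesianProductWith f []       ys = refl
length-cartesianProductWith f (x ∷ xs) ys = begin
  length (map (f x) ys ++ cartesianProductWith f xs ys)  ≡⟨ length-++ (map (f x) ys) ⟩
  length (map (f x) ys) + length (cartesianProductWith f xs ys)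
    ≡⟨ cong₂ _+_ (length-map (f x) ys) (length-cartesianProductWith f xs ys) ⟩
  length ys + length xs * length ys  ∎
  where open ≡-Reasoning

distance-shift : ∀ m t → ∣ m - m + t ∣ ≡ t
distance-shift zero    t = refl
distance-shift (suc m) t = distance-shift m t

distance-sym : ∀ i j → ∣ i - j ∣ ≡ ∣ j - i ∣
distance-sym zero    zero    = refl
distance-sym zero    (suc j) = refl
distance-sym (suc i) zero    = refl
distance-sym (suc i) (suc j) = distance-sym i j

progression : ℕ → ℕ → ℕ → List ℕ
progression zero    a d = []
progression (suc n) a d = a ∷ progression n (d + a) d

length-progression : ∀ n a d → length (progression n a d) ≡ n
length-progression zero    a d = refl
length-progression (suc n) a d = cong suc (length-progression n (d + a) d)

chain : ℕ → ℕ → List ℕ → List ℕ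
chain n a []       = a ∷ []
chain n a (d ∷ ds) = progression n a d ++ chain n (n * d + a) ds

length-chain : ∀ n a ds → length (chain n a ds) ≡ suc (length ds * n)
length-chain n a []       = refl
length-chain n a (d ∷ ds) = begin
  length (progression n a d ++ chain n (n * d + a) ds)        ≡⟨ length-++ (progression n a d) ⟩
  length (progression n a d) + length (chain n (n * d + a) ds)
    ≡⟨ cong₂ _+_ (length-progression n a d) (length-chain n (n * d + a) ds) ⟩
  n + suc (length ds * n)                                    ≡⟨ +-suc n (length ds * n) ⟩
  suc (length (d ∷ ds) * n)                                  ∎
  where open ≡-Reasoning

chain-head : ∀ n a ds → chain n a ds [ 0 ]= a
chain-head n       a []       = here
chain-head zero    a (d ∷ ds) = chain-head zero a ds
chain-head (suc n) a (d ∷ ds) = here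

progression-terms : ∀ n a d rest → rest [ 0 ]= n * d + a →
                    ∀ t → t ≤ n → (progression n a d ++ rest) [ t ]= t * d + a
progression-terms zero    a d rest next zero    z≤n       = next
progression-terms (suc n) a d rest next zero    z≤n       = here
progression-terms (suc n) a d rest next (suc t) (s≤s t≤n) =
  there (subst (λ y → (progression n (d + a) d ++ rest) [ t ]= y) (shift t) (progression-terms n (d + a) d rest
    (subst (rest [ 0 ]=_) (sym (shift n)) next) t t≤n))
  where
  shift : ∀ s → s * d + (d + a) ≡ suc s * d + a
  shift s = trans (sym (+-assoc (s * d) d a)) (cong (_+ a) (+-comm (s * d) d))

Window : List ℕ → ℕ → ℕ → Set
Window xs n d = Σ ℕ λ o → Σ ℕ λ a → ∀ t → t ≤ n → xs [ o + t ]= t * d + a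

chain-window : ∀ n a ds {d} → d ∈ ds → Window (chain n a ds) n d
chain-window n a (d ∷ ds) (here refl) =
  0 , a , progression-terms n a d (chain n (n * d + a) ds) (chain-head n (n * d + a) ds)
chain-window n a (d′ ∷ ds) {d} (there d∈ds) with chain-window n (n * d′ + a) ds d∈ds
... | o , b , terms = n + o , b , λ t t≤n →
  subst (λ i → chain n a (d′ ∷ ds) [ i ]= t * d + b) (position t)
        ([]=-++ʳ (progression n a d′) (terms t t≤n))
  where
  position : ∀ t → length (progression n a d′) + (o + t) ≡ n + o + t
  position t = trans (cong (_+ (o + t)) (length-progression n a d′)) (sym (+-assoc n o t))

module Congruence (q : ℕ) where

  P : ℕ
  P = suc q

  infix 4 _≈_
  record _≈_ (x y : ℕ) : Set where
    constructor mk≈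
    field residues : x % P ≡ y % P
  open _≈_ public

  ≈-isEquivalence : IsEquivalence _≈_
  ≈-isEquivalence = record
    { refl  = mk≈ refl
    ; sym   = λ { (mk≈ e) → mk≈ (sym e) }
    ; trans = λ { (mk≈ e) (mk≈ f) → mk≈ (trans e f) }
    }

  ≈-setoid : Setoid 0ℓ 0ℓ
  ≈-setoid = record { isEquivalence = ≈-isEquivalence }

  open IsEquivalence ≈-isEquivalence public
    using () renaming (refl to ≈-refl; sym to ≈-sym; trans to ≈-trans; reflexive to ≈-reflexive)
  module ≈-Reasoning = SetoidReasoning ≈-setoid

  +-cong : ∀ {a b c d} → a ≈ b → c ≈ d → a + c ≈ b + d
  +-cong {a} {b} {c} {d} (mk≈ e₁) (mk≈ e₂) = mk≈ (begin
    (a + c) % P          ≡⟨ %-distribˡ-+ a c P ⟩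
    (a % P + c % P) % P  ≡⟨ cong₂ (λ u v → (u + v) % P) e₁ e₂ ⟩
    (b % P + d % P) % P  ≡⟨ %-distribˡ-+ b d P ⟨
    (b + d) % P          ∎)
    where open ≡-Reasoning

  *-cong : ∀ {a b c d} → a ≈ b → c ≈ d → a * c ≈ b * d
  *-cong {a} {b} {c} {d} (mk≈ e₁) (mk≈ e₂) = mk≈ (begin
    (a * c) % P              ≡⟨ %-distribˡ-* a c P ⟩
    (a % P * (c % P)) % P    ≡⟨ cong₂ (λ u v → (u * v) % P) e₁ e₂ ⟩
    (b % P * (d % P)) % P    ≡⟨ %-distribˡ-* b d P ⟨
    (b * d) % P              ∎)
    where open ≡-Reasoning

  +-congˡ : ∀ a {b c} → b ≈ c → a + b ≈ a + c
  +-congˡ a = +-cong (≈-refl {a})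

  *-congˡ : ∀ a {b c} → b ≈ c → a * b ≈ a * c
  *-congˡ a = *-cong (≈-refl {a})

  *-congʳ : ∀ c {a b} → a ≈ b → a * c ≈ b * c
  *-congʳ c e = *-cong e (≈-refl {c})

  ^-congˡ : ∀ {a b} → a ≈ b → ∀ k → a ^ k ≈ b ^ k
  ^-congˡ e zero    = ≈-refl
  ^-congˡ e (suc k) = *-cong e (^-congˡ e k)

  %-≈ : ∀ x → x % P ≈ x
  %-≈ x = mk≈ (m%n%n≡m%n x P)

  -- Multiples of P vanish; in particular a + q·a = P·a ≈ 0, so q plays the role of -1.
  P≈0 : P ≈ 0
  P≈0 = mk≈ (n%n≡0 P)

  *P≈0 : ∀ k → k * P ≈ 0
  *P≈0 k = mk≈ (m*n%n≡0 k P)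

  P*≈0 : ∀ k → P * k ≈ 0
  P*≈0 k = ≈-trans (≈-reflexive (*-comm P k)) (*P≈0 k)

  -- Addition can be cancelled by adding q·a ≈ -a.
  +-cancelˡ : ∀ a {b c} → a + b ≈ a + c → b ≈ c
  +-cancelˡ a {b} {c} e = begin
    b                ≈⟨ absorb b ⟨
    q * a + (a + b)  ≈⟨ +-congˡ (q * a) e ⟩
    q * a + (a + c)  ≈⟨ absorb c ⟩
    c                ∎
    where
    open ≈-Reasoning
    absorb : ∀ x → q * a + (a + x) ≈ x
    absorb x = begin
      q * a + (a + x)  ≡⟨ +-assoc (q * a) a x ⟨
      q * a + a + x    ≡⟨ cong (_+ x) (+-comm (q * a) a) ⟩
      P * a + x        ≈⟨ +-cong (P*≈0 a) (≈-refl {x}) ⟩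
      x                ∎

  q*q≈1 : q * q ≈ 1
  q*q≈1 = begin
    q * q          ≡⟨ +-identityʳ (q * q) ⟨
    q * q + 0      ≈⟨ +-congˡ (q * q) P≈0 ⟨
    q * q + P      ≡⟨ trans (+-suc (q * q) q) (cong suc (+-comm (q * q) q)) ⟩
    1 + P * q      ≈⟨ +-congˡ 1 (P*≈0 q) ⟩
    1              ∎
    where open ≈-Reasoning

  sign : Bool → ℕ
  sign false = 1
  sign true  = q

  sign-xor : ∀ b b′ → sign b * sign b′ ≈ sign (b xor b′)
  sign-xor false false = ≈-refl
  sign-xor false true  = ≈-reflexive (*-identityˡ q)
  sign-xor true  false = ≈-reflexive (*-identityʳ q)
  sign-xor true  true  = q*q≈1

  sign-square : ∀ b → sign b * sign b ≈ 1
  sign-square false = ≈-refl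
  sign-square true  = q*q≈1

  even-power-of-involution : ∀ {x} → x * x ≈ 1 → ∀ j → x ^ (2 * j) ≈ 1
  even-power-of-involution {x} x²≈1 j = begin
    x ^ (2 * j)      ≡⟨ ^-double x j ⟩
    x ^ j * x ^ j    ≡⟨ ^-distribʳ-* x x j ⟨
    (x * x) ^ j      ≈⟨ ^-congˡ x²≈1 j ⟩
    1 ^ j            ≡⟨ ^-zeroˡ j ⟩
    1                ∎
    where open ≈-Reasoning

  toFin : ℕ → Fin P
  toFin x = fromℕ< (m%n<n x P)

  toFin-≈ : ∀ v (x : Fin P) → v ≈ toℕ x → toFin v ≡ x
  toFin-≈ v x (mk≈ e) = toℕ-injective (begin
    toℕ (toFin v)  ≡⟨ toℕ-fromℕ< (m%n<n v P) ⟩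
    v % P          ≡⟨ e ⟩
    toℕ x % P      ≡⟨ m<n⇒m%n≡m (toℕ<n x) ⟩
    toℕ x          ∎)
    where open ≡-Reasoning

module PrimeModulus (q : ℕ) (2≤q : 2 ≤ q) (P-prime : Prime (suc q)) where

  open Congruence q

  Unit : ℕ → Set
  Unit c = ¬ P ∣ c

  ≈0⇒∣ : ∀ {x} → x ≈ 0 → P ∣ x
  ≈0⇒∣ {x} (mk≈ e) = m%n≡0⇒n∣m x P e

  ∣⇒≈0 : ∀ {x} → P ∣ x → x ≈ 0
  ∣⇒≈0 {x} P∣x = mk≈ (n∣m⇒m%n≡0 x P P∣x)

  unit-small : ∀ {c} → 0 < c → c < P → Unit c
  unit-small {suc c} _ c<P = >⇒∤ c<P

  unit-* : ∀ {a b} → Unit a → Unit b → Unit (a * b)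
  unit-* {a} {b} unit-a unit-b P∣ab with euclidsLemma a b P-prime P∣ab
  ... | inj₁ P∣a = unit-a P∣a
  ... | inj₂ P∣b = unit-b P∣b

  unit-1 : Unit 1
  unit-1 = unit-small (s≤s z≤n) (s≤s (≤-trans (s≤s z≤n) 2≤q))

  unit-^ : ∀ {a} → Unit a → ∀ m → Unit (a ^ m)
  unit-^ unit-a zero    = unit-1
  unit-^ unit-a (suc m) = unit-* unit-a (unit-^ unit-a m)

  1≉q : ¬ 1 ≈ q
  1≉q (mk≈ e) = <⇒≢ 2≤q (begin
    1      ≡⟨ m<n⇒m%n≡m (s≤s (≤-trans (s≤s z≤n) 2≤q)) ⟨
    1 % P  ≡⟨ e ⟩
    q % P  ≡⟨ m<n⇒m%n≡m ≤-refl ⟩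
    q      ∎)
    where open ≡-Reasoning

  unit-residue : ∀ {d} → Unit d → Σ ℕ λ r → suc r < P × d ≈ suc r
  unit-residue {d} unit-d with d % P in residue
  ... | zero  = ⊥-elim (unit-d (≈0⇒∣ (mk≈ residue)))
  ... | suc r = r , r<P , mk≈ (trans residue (sym (m<n⇒m%n≡m r<P)))
    where
    r<P : suc r < P
    r<P = subst (_< P) residue (m%n<n d P)

  unit-residue-positive : ∀ {d} → Unit d → 0 < d % P
  unit-residue-positive unit-d with unit-residue unit-d
  ... | r , r<P , mk≈ d≡r = subst (0 <_) (sym (trans d≡r (m<n⇒m%n≡m r<P))) (s≤s z≤n)

  power-one⇒unit : ∀ {a} m → a ^ suc m ≈ 1 → Unit a
  power-one⇒unit {a} m a^m≈1 P∣a = unit-1 (≈0⇒∣ (begin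
    1              ≈⟨ a^m≈1 ⟨
    a * a ^ m      ≈⟨ *-congʳ (a ^ m) (∣⇒≈0 P∣a) ⟩
    0              ∎))
    where open ≈-Reasoning

  inverse : ∀ {d} → Unit d → Σ ℕ λ e → d * e ≈ 1
  inverse {d} unit-d with unit-residue unit-d
  ... | r′ , r<P , d≈r with coprime-Bézout (prime⇒coprime P-prime r<P)
  ...   | Bézout.-+ x y eq = y , (begin
          d * y        ≈⟨ *-congʳ y d≈r ⟩
          suc r′ * y   ≡⟨ trans (*-comm (suc r′) y) (sym eq) ⟩
          1 + x * P    ≈⟨ +-congˡ 1 (*P≈0 x) ⟩
          1            ∎)
    where open ≈-Reasoning
  ...   | Bézout.+- x y eq = y * q , (begin
          d * (y * q)       ≈⟨ *-congʳ (y * q) d≈r ⟩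
          suc r′ * (y * q)  ≡⟨ *-assoc (suc r′) y q ⟨
          suc r′ * y * q    ≈⟨ *-congʳ q ry≈q ⟩
          q * q             ≈⟨ q*q≈1 ⟩
          1                 ∎)
    where
    open ≈-Reasoning
    ry≈q : suc r′ * y ≈ q
    ry≈q = +-cancelˡ 1 (begin
      1 + suc r′ * y  ≡⟨ cong suc (*-comm (suc r′) y) ⟩
      1 + y * suc r′  ≡⟨ eq ⟩
      x * P           ≈⟨ *P≈0 x ⟩
      0               ≈⟨ P≈0 ⟨
      1 + q           ∎)

  *-cancelˡ : ∀ {c x y} → Unit c → c * x ≈ c * y → x ≈ y
  *-cancelˡ {c} {x} {y} unit-c cx≈cy with inverse unit-c
  ... | e , ce≈1 = begin
    x            ≡⟨ *-identityˡ x ⟨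
    1 * x        ≈⟨ *-congʳ x ce≈1 ⟨
    c * e * x    ≡⟨ rotate c e x ⟩
    e * (c * x)  ≈⟨ *-congˡ e cx≈cy ⟩
    e * (c * y)  ≡⟨ rotate c e y ⟨
    c * e * y    ≈⟨ *-congʳ y ce≈1 ⟩
    1 * y        ≡⟨ *-identityˡ y ⟩
    y            ∎
    where
    open ≈-Reasoning
    rotate : ∀ a b z → a * b * z ≡ b * (a * z)
    rotate = solve-∀

  solve-linear : ∀ {d} → Unit d → ∀ a x → Σ ℕ λ k → k < P × k * d + a ≈ x
  solve-linear {d} unit-d a x with inverse unit-d
  ... | e , de≈1 = k , m%n<n (y * e) P , (begin
    k * d + a              ≈⟨ +-cong (*-congʳ d (%-≈ (y * e))) (≈-refl {a}) ⟩
    y * e * d + a          ≡⟨ cong (_+ a) (rearrange y e d) ⟩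
    y * (d * e) + a        ≈⟨ +-cong (*-congˡ y de≈1) (≈-refl {a}) ⟩
    y * 1 + a              ≡⟨ unfold x q a ⟩
    x + P * a              ≈⟨ +-congˡ x (P*≈0 a) ⟩
    x + 0                  ≡⟨ +-identityʳ x ⟩
    x                      ∎)
    where
    open ≈-Reasoning
    -- y ≈ x - a, and k ≈ y / d.
    y : ℕ
    y = x + q * a
    k : ℕ
    k = (y * e) % P
    rearrange : ∀ u v w → u * v * w ≡ u * (w * v)
    rearrange = solve-∀
    unfold : ∀ x q a → (x + q * a) * 1 + a ≡ x + (a + q * a)
    unfold = solve-∀

  -- The only square roots of 1 are ±1, since (x + q)(x + 1) ≈ x² - 1.
  square-root-of-1 : ∀ {x} → x * x ≈ 1 → (x ≈ 1) ⊎ (x ≈ q)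
  square-root-of-1 {x} x²≈1 with euclidsLemma (x + q) (x + 1) P-prime (≈0⇒∣ product≈0)
    where
    expand : ∀ x q → (x + q) * (x + 1) ≡ x * x + q + (x + q * x)
    expand = solve-∀
    product≈0 : (x + q) * (x + 1) ≈ 0
    product≈0 = begin
      (x + q) * (x + 1)          ≡⟨ expand x q ⟩
      x * x + q + P * x          ≈⟨ +-cong (+-cong x²≈1 (≈-refl {q})) (P*≈0 x) ⟩
      P + 0                      ≡⟨ +-identityʳ P ⟩
      P                          ≈⟨ P≈0 ⟩
      0                          ∎
      where open ≈-Reasoning
  ... | inj₁ P∣x+q = inj₁ (+-cancelˡ q (begin
    q + x  ≡⟨ +-comm q x ⟩
    x + q  ≈⟨ ∣⇒≈0 P∣x+q ⟩
    0      ≈⟨ P≈0 ⟨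
    1 + q  ≡⟨ +-comm 1 q ⟩
    q + 1  ∎))
    where open ≈-Reasoning
  ... | inj₂ P∣x+1 = inj₂ (+-cancelˡ 1 (begin
    1 + x  ≡⟨ +-comm 1 x ⟩
    x + 1  ≈⟨ ∣⇒≈0 P∣x+1 ⟩
    0      ≈⟨ P≈0 ⟨
    1 + q  ∎))
    where open ≈-Reasoning

  Covers : ℕ → List ℕ → Set
  Covers k ds = ∀ r → 0 < r → r < P →
    Σ ℕ λ d → d ∈ ds × Unit d × Σ ℕ λ t → t ≤ k × Σ Bool λ b → r ≈ sign b * (t * d)

  Close : ℕ → List (Fin P) → Fin P → Fin P → Set
  Close k xs x y = Σ ℕ λ i → Σ ℕ λ j → xs [ i ]= x × xs [ j ]= y × ∣ i - j ∣ ≤ k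

  close-sym : ∀ {k xs x y} → Close k xs x y → Close k xs y x
  close-sym {k} (i , j , at-x , at-y , i~j) = j , i , at-y , at-x , subst (_≤ k) (distance-sym i j) i~j

  -- In a window of q + k + 1 terms with unit difference d, every residue x occurs,
  -- and x + t·d (t ≤ k) occurs t positions later.
  window-close : ∀ {k xs d t} (x y : Fin P) → Window xs (q + k) d → Unit d → t ≤ k →
                 toℕ x + t * d ≈ toℕ y → Close k (map toFin xs) x y
  window-close {k} {xs} {d} {t} x y (o , a , terms) unit-d t≤k x+td≈y =
    close-at (solve-linear unit-d a (toℕ x))
    where
    -- x is the s-th term of the window, y the (s + t)-th.
    close-at : (Σ ℕ λ s → s < P × s * d + a ≈ toℕ x) → Close k (map toFin xs) x y
    close-at (s , s<P , sd+a≈x) = o + s , o + (s + t) , at-x , at-y , distance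
      where
      at-x : map toFin xs [ o + s ]= x
      at-x = subst (map toFin xs [ o + s ]=_) (toFin-≈ (s * d + a) x sd+a≈x)
                   ([]=-map toFin (terms s (≤-trans (s≤s⁻¹ s<P) (m≤m+n q k))))
      term≈y : (s + t) * d + a ≈ toℕ y
      term≈y = begin
        (s + t) * d + a    ≡⟨ split-term s t d a ⟩
        s * d + a + t * d  ≈⟨ +-cong sd+a≈x (≈-refl {t * d}) ⟩
        toℕ x + t * d      ≈⟨ x+td≈y ⟩
        toℕ y              ∎
        where
        open ≈-Reasoning
        split-term : ∀ s t d a → (s + t) * d + a ≡ s * d + a + t * d
        split-term = solve-∀
      at-y : map toFin xs [ o + (s + t) ]= y
      at-y = subst (map toFin xs [ o + (s + t) ]=_) (toFin-≈ ((s + t) * d + a) y term≈y)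
                   ([]=-map toFin (terms (s + t) (+-mono-≤ (s≤s⁻¹ s<P) t≤k)))
      distance : ∣ o + s - o + (s + t) ∣ ≤ k
      distance = subst (_≤ k) (sym (trans (cong (∣ o + s -_∣) (sym (+-assoc o s t)))
                                          (distance-shift (o + s) t))) t≤k

  all-close⇒radius : ∀ {k as} → (∀ x y → x ≢ y → Close k as x y) → IsRadiusSeq P k as
  all-close⇒radius all-close x y x≢y with all-close x y x≢y
  ... | i , j , at-x , at-y , i~j with []=⇒lookup at-x | []=⇒lookup at-y
  ...   | i< , lookup-x | j< , lookup-y = i , j , i< , j< , lookup-x , lookup-y , i~j

  chain-radius : ∀ k ds → Covers k ds → IsRadiusSeq P k (map toFin (chain (q + k) 0 ds))
  chain-radius k ds covers = all-close⇒radius close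
    where
    xs : List ℕ
    xs = chain (q + k) 0 ds
    close-ordered : ∀ x y → toℕ x < toℕ y → Close k (map toFin xs) x y
    close-ordered x y x<y
      with covers (toℕ y ∸ toℕ x) (m<n⇒0<n∸m x<y) (≤-<-trans (m∸n≤m (toℕ y) (toℕ x)) (toℕ<n y))
    ... | d , d∈ds , unit-d , t , t≤k , false , r≈td =
      window-close x y (chain-window (q + k) 0 ds d∈ds) unit-d t≤k (begin
        toℕ x + t * d                ≡⟨ cong (toℕ x +_) (*-identityˡ (t * d)) ⟨
        toℕ x + 1 * (t * d)          ≈⟨ +-congˡ (toℕ x) r≈td ⟨
        toℕ x + (toℕ y ∸ toℕ x)      ≡⟨ m+[n∸m]≡n (<⇒≤ x<y) ⟩
        toℕ y                        ∎)
      where open ≈-Reasoning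
    ... | d , d∈ds , unit-d , t , t≤k , true , r≈-td =
      close-sym (window-close y x (chain-window (q + k) 0 ds d∈ds) unit-d t≤k (begin
        toℕ y + t * d                      ≡⟨ cong (_+ t * d) (m+[n∸m]≡n (<⇒≤ x<y)) ⟨
        toℕ x + (toℕ y ∸ toℕ x) + t * d    ≡⟨ +-assoc (toℕ x) _ (t * d) ⟩
        toℕ x + ((toℕ y ∸ toℕ x) + t * d)  ≈⟨ +-congˡ (toℕ x) (+-cong r≈-td (≈-refl {t * d})) ⟩
        toℕ x + (q * (t * d) + t * d)      ≡⟨ cong (toℕ x +_) (+-comm (q * (t * d)) (t * d)) ⟩
        toℕ x + P * (t * d)                ≈⟨ +-congˡ (toℕ x) (P*≈0 (t * d)) ⟩
        toℕ x + 0                          ≡⟨ +-identityʳ (toℕ x) ⟩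
        toℕ x                              ∎))
      where open ≈-Reasoning
    close : ∀ x y → x ≢ y → Close k (map toFin xs) x y
    close x y x≢y with <-cmp (toℕ x) (toℕ y)
    ... | tri< x<y _ _ = close-ordered x y x<y
    ... | tri≈ _ x≡y _ = ⊥-elim (x≢y (toℕ-injective x≡y))
    ... | tri> _ _ y<x = close-sym (close-ordered y x y<x)

  -- Every orbit has exactly n elements; representing each
  -- orbit by its least element, the orbits are counted by a list reps with
  -- length reps * n ≤ q.
  module Orbits (h n : ℕ) (order : IsMultOrder h P n) where

    private
      n≥1 : 1 ≤ n
      n≥1 = proj₁ order

      h^n≈1 : h ^ n ≈ 1
      h^n≈1 = mk≈ (proj₁ (proj₂ order))

      minimal : ∀ m → 1 ≤ m → h ^ m ≈ 1 → n ≤ m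
      minimal m m≥1 (mk≈ e) = proj₂ (proj₂ order) m m≥1 e

    instance
      n-nonZero : NonZero n
      n-nonZero = >-nonZero n≥1

    unit-h : Unit h
    unit-h = power-one⇒unit (n ∸ 1) (subst (λ m → h ^ m ≈ 1) (sym (m+[n∸m]≡n n≥1)) h^n≈1)

    power-multiple : ∀ k → h ^ (n * k) ≈ 1
    power-multiple k = begin
      h ^ (n * k)    ≡⟨ ^-*-assoc h n k ⟨
      (h ^ n) ^ k    ≈⟨ ^-congˡ h^n≈1 k ⟩
      1 ^ k          ≡⟨ ^-zeroˡ k ⟩
      1              ∎
      where open ≈-Reasoning

    power-mod : ∀ e → h ^ e ≈ h ^ (e % n)
    power-mod e = begin
      h ^ e                             ≡⟨ cong (h ^_) (m≡m%n+[m/n]*n e n) ⟩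
      h ^ (e % n + e / n * n)           ≡⟨ ^-distribˡ-+-* h (e % n) (e / n * n) ⟩
      h ^ (e % n) * h ^ (e / n * n)     ≡⟨ cong (λ m → h ^ (e % n) * h ^ m) (*-comm (e / n) n) ⟩
      h ^ (e % n) * h ^ (n * (e / n))   ≈⟨ *-congˡ (h ^ (e % n)) (power-multiple (e / n)) ⟩
      h ^ (e % n) * 1                   ≡⟨ *-identityʳ (h ^ (e % n)) ⟩
      h ^ (e % n)                       ∎
      where open ≈-Reasoning

    no-repeat : ∀ {e e′} → e < e′ → e′ < n → ¬ h ^ e ≈ h ^ e′
    no-repeat {e} {e′} e<e′ e′<n h^e≈h^e′ =
      <⇒≱ (≤-<-trans (m∸n≤m e′ e) e′<n) (minimal (e′ ∸ e) (m<n⇒0<n∸m e<e′) h^d≈1)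
      where
      h^d≈1 : h ^ (e′ ∸ e) ≈ 1
      h^d≈1 = *-cancelˡ (unit-^ unit-h e) (begin
        h ^ e * h ^ (e′ ∸ e)   ≡⟨ ^-distribˡ-+-* h e (e′ ∸ e) ⟨
        h ^ (e + (e′ ∸ e))     ≡⟨ cong (h ^_) (m+[n∸m]≡n (<⇒≤ e<e′)) ⟩
        h ^ e′                 ≈⟨ h^e≈h^e′ ⟨
        h ^ e                  ≡⟨ *-identityʳ (h ^ e) ⟨
        h ^ e * 1              ∎)
        where open ≈-Reasoning

    power-injective : ∀ {e e′} → e < n → e′ < n → h ^ e ≈ h ^ e′ → e ≡ e′
    power-injective {e} {e′} e<n e′<n h^e≈h^e′ with <-cmp e e′
    ... | tri< e<e′ _ _ = ⊥-elim (no-repeat e<e′ e′<n h^e≈h^e′)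
    ... | tri≈ _ e≡e′ _ = e≡e′
    ... | tri> _ _ e′<e = ⊥-elim (no-repeat e′<e e<n (≈-sym h^e≈h^e′))

    Orbit : ℕ → ℕ → Set
    Orbit u v = Σ ℕ λ e → u ≈ h ^ e * v

    orbit-refl : ∀ u → Orbit u u
    orbit-refl u = 0 , ≈-reflexive (sym (*-identityˡ u))

    orbit-trans : ∀ {u v w} → Orbit u v → Orbit v w → Orbit u w
    orbit-trans {u} {v} {w} (e , u≈) (e′ , v≈) = e + e′ , (begin
      u                     ≈⟨ u≈ ⟩
      h ^ e * v             ≈⟨ *-congˡ (h ^ e) v≈ ⟩
      h ^ e * (h ^ e′ * w)  ≡⟨ *-assoc (h ^ e) (h ^ e′) w ⟨
      h ^ e * h ^ e′ * w    ≡⟨ cong (_* w) (^-distribˡ-+-* h e e′) ⟨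
      h ^ (e + e′) * w      ∎)
      where open ≈-Reasoning

    -- The inverse of h ^ e is h ^ ((n - 1) e).
    orbit-sym : ∀ {u v} → Orbit u v → Orbit v u
    orbit-sym {u} {v} (e , u≈) = f , (begin
      v                  ≡⟨ *-identityˡ v ⟨
      1 * v              ≈⟨ *-congʳ v (power-multiple e) ⟨
      h ^ (n * e) * v    ≡⟨ cong (λ m → h ^ m * v) exponent ⟨
      h ^ (f + e) * v    ≡⟨ cong (_* v) (^-distribˡ-+-* h f e) ⟩
      h ^ f * h ^ e * v  ≡⟨ *-assoc (h ^ f) (h ^ e) v ⟩
      h ^ f * (h ^ e * v) ≈⟨ *-congˡ (h ^ f) u≈ ⟨
      h ^ f * u          ∎)
      where
      open ≈-Reasoning
      f : ℕ
      f = (n ∸ 1) * e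
      exponent : f + e ≡ n * e
      exponent = trans (+-comm f e) (cong (_* e) (m+[n∸m]≡n n≥1))

    Rep : ℕ → Set
    Rep c = 0 < c × c < P × ((e : Fin n) → c ≤ (h ^ toℕ e * c) % P)

    rep? : ∀ c → Dec (Rep c)
    rep? c = 0 <? c ×-dec c <? P ×-dec all? (λ e → c ≤? (h ^ toℕ e * c) % P)

    rep-least : ∀ {c v} → Rep c → Orbit v c → v < P → c ≤ v
    rep-least {c} {v} (_ , _ , least) (e , v≈) v<P = begin
      c                                       ≤⟨ least (fromℕ< (m%n<n e n)) ⟩
      (h ^ toℕ (fromℕ< (m%n<n e n)) * c) % P  ≡⟨ cong (λ m → (h ^ m * c) % P) (toℕ-fromℕ< (m%n<n e n)) ⟩
      (h ^ (e % n) * c) % P                   ≡⟨ residues (≈-trans v≈ (*-congʳ c (power-mod e))) ⟨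
      v % P                                   ≡⟨ m<n⇒m%n≡m v<P ⟩
      v                                       ∎
      where open ≤-Reasoning

    -- Every nonzero residue lies in the orbit of a representative: descend to a
    -- smaller element of the orbit until none exists.
    rep-exists : ∀ r → 0 < r → r < P → Σ ℕ λ c → Rep c × Orbit r c
    rep-exists = <-rec _ descend
      where
      descend : ∀ r → (∀ {s} → s < r → 0 < s → s < P → Σ ℕ λ c → Rep c × Orbit s c) →
                0 < r → r < P → Σ ℕ λ c → Rep c × Orbit r c
      descend r smaller r>0 r<P = decide (rep? r)
        where
        Goal : Set
        Goal = Σ ℕ λ c → Rep c × Orbit r c
        next : Fin n → ℕ
        next e = (h ^ toℕ e * r) % P
        descend-from : Σ (Fin n) (λ e → ¬ r ≤ next e) → Goal
        descend-from (e , r≰next) = extend (smaller (≰⇒> r≰next) next>0 (m%n<n (h ^ toℕ e * r) P))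
          where
          next>0 : 0 < next e
          next>0 = unit-residue-positive (unit-* (unit-^ unit-h (toℕ e)) (unit-small r>0 r<P))
          extend : Σ ℕ (λ c → Rep c × Orbit (next e) c) → Goal
          extend (c , rep-c , next~c) =
            c , rep-c , orbit-trans (orbit-sym (toℕ e , %-≈ (h ^ toℕ e * r))) next~c
        decide : Dec (Rep r) → Goal
        decide (yes rep-r) = r , rep-r , orbit-refl r
        decide (no ¬rep-r) = descend-from (¬∀⟶∃¬ n (λ e → r ≤ next e) (λ e → r ≤? next e)
                                                  (λ least → ¬rep-r (r>0 , r<P , least)))

    rep-unique : ∀ {c c′ e e′} → Rep c → Rep c′ → e < n → e′ < n →
                 h ^ e * c ≈ h ^ e′ * c′ → c ≡ c′ × e ≡ e′
    rep-unique {c} {c′} {e} {e′} rep-c rep-c′ e<n e′<n same = c≡c′ , e≡e′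
      where
      c′~c : Orbit c′ c
      c′~c = orbit-trans (orbit-sym (e′ , same)) (e , ≈-refl)
      c≡c′ : c ≡ c′
      c≡c′ = ≤-antisym (rep-least rep-c c′~c (proj₁ (proj₂ rep-c′)))
                       (rep-least rep-c′ (orbit-sym c′~c) (proj₁ (proj₂ rep-c)))
      e≡e′ : e ≡ e′
      e≡e′ = power-injective e<n e′<n (*-cancelˡ (unit-small (proj₁ rep-c) (proj₁ (proj₂ rep-c))) (begin
        c * h ^ e    ≡⟨ *-comm c (h ^ e) ⟩
        h ^ e * c    ≈⟨ same ⟩
        h ^ e′ * c′  ≡⟨ cong (h ^ e′ *_) c≡c′ ⟨
        h ^ e′ * c   ≡⟨ *-comm (h ^ e′) c ⟩
        c * h ^ e′   ∎))
        where open ≈-Reasoning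

    reps : List ℕ
    reps = filter rep? (upTo P)

    rep∈reps : ∀ {c} → Rep c → c ∈ reps
    rep∈reps rep-c = ∈-filter⁺ rep? (∈-upTo⁺ (proj₁ (proj₂ rep-c))) rep-c

    reps-rep : ∀ i → Rep (lookup reps i)
    reps-rep i = proj₂ (∈-filter⁻ rep? {xs = upTo P} (∈-lookup i))

    orbit-element : Fin (length reps) → Fin n → ℕ
    orbit-element a e = (h ^ toℕ e * lookup reps a) % P

    orbit-element-positive : ∀ a e → 0 < orbit-element a e
    orbit-element-positive a e = unit-residue-positive
      (unit-* (unit-^ unit-h (toℕ e)) (unit-small (proj₁ (reps-rep a)) (proj₁ (proj₂ (reps-rep a)))))

    orbit-element<P : ∀ a e → orbit-element a e < P
    orbit-element<P a e = m%n<n (h ^ toℕ e * lookup reps a) P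

    orbit-element-injective : ∀ a e a′ e′ → orbit-element a e ≡ orbit-element a′ e′ → (a , e) ≡ (a′ , e′)
    orbit-element-injective a e a′ e′ eq =
      cong₂ _,_ (lookup-injective (filter⁺ rep? (upTo⁺ P)) a a′ (proj₁ same)) (toℕ-injective (proj₂ same))
      where
      same : lookup reps a ≡ lookup reps a′ × toℕ e ≡ toℕ e′
      same = rep-unique (reps-rep a) (reps-rep a′) (toℕ<n e) (toℕ<n e′) (mk≈ eq)

    -- The orbits are disjoint, of size n, and avoid 0, so together they use at
    -- most q residues: (a, e) ↦ orbit-element a e - 1 is an injection into Fin q.
    orbit-count : length reps * n ≤ q
    orbit-count = injective⇒≤ {f = index} index-injective
      where
      split : Fin (length reps * n) → Fin (length reps) × Fin n
      split = remQuot {length reps} n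
      value : Fin (length reps * n) → ℕ
      value i = uncurry orbit-element (split i)
      value>0 : ∀ i → 0 < value i
      value>0 i = orbit-element-positive (proj₁ (split i)) (proj₂ (split i))
      index : Fin (length reps * n) → Fin q
      index i = fromℕ< (∸-monoˡ-< (orbit-element<P (proj₁ (split i)) (proj₂ (split i))) (value>0 i))
      index-injective : ∀ {i j} → index i ≡ index j → i ≡ j
      index-injective {i} {j} eq = begin
        i                          ≡⟨ combine-remQuot {length reps} n i ⟨
        uncurry combine (split i)  ≡⟨ cong (uncurry combine) same-split ⟩
        uncurry combine (split j)  ≡⟨ combine-remQuot {length reps} n j ⟩
        j                          ∎
        where
        open ≡-Reasoning
        same-value : value i ≡ value j
        same-value = ∸-cancelʳ-≡ (value>0 i) (value>0 j)
          (trans (sym (toℕ-fromℕ< _)) (trans (cong toℕ eq) (toℕ-fromℕ< _)))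
        same-split : split i ≡ split j
        same-split = orbit-element-injective _ _ _ _ same-value

  BoundWith : ℕ → ℕ → Set
  BoundWith x y = Σ ℕ λ B → fLe 2 P B × (4 * x * B ≤ (P + 1) * q * y + 4 * x)

  -- Such an h has order 2L, and every element of
  -- the orbit of a representative c is ±h ^ f · c with f < L, i.e. ±t · h ^ (2j) · c
  -- with t ∈ {1, 2} and 2j ≤ f.  So for L ≤ 2K the differences h ^ (2j) · c with
  -- j < K cover every residue within radius 2.
  module Covering (h L : ℕ) (s : Bool) (h≈±2 : h ≈ sign s * 2) (h^L≈-1 : h ^ L ≈ q)
                  (no-root : ∀ d → 0 < d → d < L → ¬ h ^ (2 * d) ≈ 1) where

    square-of-sign : ∀ d b → h ^ d ≈ sign b → h ^ (2 * d) ≈ 1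
    square-of-sign d b h^d≈± = begin
      h ^ (2 * d)      ≡⟨ ^-double h d ⟩
      h ^ d * h ^ d    ≈⟨ *-cong h^d≈± h^d≈± ⟩
      sign b * sign b  ≈⟨ sign-square b ⟩
      1                ∎
      where open ≈-Reasoning

    L>0 : 0 < L
    L>0 = positive L h^L≈-1
      where
      positive : ∀ m → h ^ m ≈ q → 0 < m
      positive zero    h^0≈-1 = ⊥-elim (1≉q h^0≈-1)
      positive (suc m) _      = s≤s z≤n

    below-order : ∀ m → 0 < m → m < 2 * L → ¬ h ^ m ≈ 1
    below-order m m>0 m<2L h^m≈1 with <-cmp m L
    ... | tri< m<L _ _ = no-root m m>0 m<L (square-of-sign m false h^m≈1)
    ... | tri≈ _ m≡L _ = 1≉q (≈-trans (≈-sym h^m≈1) (subst (λ k → h ^ k ≈ q) (sym m≡L) h^L≈-1))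
    ... | tri> _ _ L<m = no-root d (m<n⇒0<n∸m L<m) d<L (square-of-sign d true h^d≈-1)
      where
      d : ℕ
      d = m ∸ L
      d<L : d < L
      d<L = ∸-below-double (<⇒≤ L<m) m<2L
      -- h ^ L · h ^ d = h ^ m ≈ 1 and h ^ L ≈ -1 give h ^ d ≈ -1.
      h^d≈-1 : h ^ d ≈ q
      h^d≈-1 = begin
        h ^ d                ≡⟨ *-identityˡ (h ^ d) ⟨
        1 * h ^ d            ≈⟨ *-congʳ (h ^ d) q*q≈1 ⟨
        q * q * h ^ d        ≡⟨ *-assoc q q (h ^ d) ⟩
        q * (q * h ^ d)      ≈⟨ *-congˡ q (*-congʳ (h ^ d) h^L≈-1) ⟨
        q * (h ^ L * h ^ d)  ≡⟨ cong (q *_) (^-distribˡ-+-* h L d) ⟨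
        q * h ^ (L + d)      ≡⟨ cong (λ k → q * h ^ k) (m+[n∸m]≡n (<⇒≤ L<m)) ⟩
        q * h ^ m            ≈⟨ *-congˡ q h^m≈1 ⟩
        q * 1                ≡⟨ *-identityʳ q ⟩
        q                    ∎
        where open ≈-Reasoning

    order : IsMultOrder h P (2 * L)
    order = ≤-trans L>0 (m≤m+n L (L + 0)) , residues (square-of-sign L true h^L≈-1) , minimal
      where
      minimal : ∀ m → 1 ≤ m → h ^ m % P ≡ 1 % P → 2 * L ≤ m
      minimal m m≥1 h^m≡1 = ≮⇒≥ (λ m<2L → below-order m m≥1 m<2L (mk≈ h^m≡1))

    open Orbits h (2 * L) order

    -- Multiplying by h ^ L ≈ -1 folds an exponent below 2L to a sign and an
    -- exponent below L.
    half-turn : ∀ e → e < 2 * L → Σ Bool λ b → Σ ℕ λ f → f < L × h ^ e ≈ sign b * h ^ f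
    half-turn e e<2L = decide (e <? L)
      where
      decide : Dec (e < L) → Σ Bool λ b → Σ ℕ λ f → f < L × h ^ e ≈ sign b * h ^ f
      decide (yes e<L) = false , e , e<L , ≈-reflexive (sym (*-identityˡ (h ^ e)))
      decide (no e≮L)  = true , e ∸ L , ∸-below-double L≤e e<2L , (begin
        h ^ e                ≡⟨ cong (h ^_) (m+[n∸m]≡n L≤e) ⟨
        h ^ (L + (e ∸ L))    ≡⟨ ^-distribˡ-+-* h L (e ∸ L) ⟩
        h ^ L * h ^ (e ∸ L)  ≈⟨ *-congʳ (h ^ (e ∸ L)) h^L≈-1 ⟩
        q * h ^ (e ∸ L)      ∎)
        where
        open ≈-Reasoning
        L≤e : L ≤ e
        L≤e = ≮⇒≥ e≮L

    module Differences (K : ℕ) (L≤2K : L ≤ 2 * K) where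

      differences : List ℕ
      differences = cartesianProductWith (λ c j → h ^ (2 * j) * c) reps (upTo K)

      Covered : ℕ → Set
      Covered x = Σ ℕ λ d → d ∈ differences × Unit d ×
                  Σ ℕ λ t → t ≤ 2 × Σ Bool λ b → x ≈ sign b * (t * d)

      covered-resp : ∀ {x y} → x ≈ y → Covered y → Covered x
      covered-resp x≈y (d , d∈ , unit-d , t , t≤2 , b , y≈) = d , d∈ , unit-d , t , t≤2 , b , ≈-trans x≈y y≈

      difference : ∀ {c} j → Rep c → 2 * j < L →
                   h ^ (2 * j) * c ∈ differences × Unit (h ^ (2 * j) * c)
      difference {c} j rep-c 2j<L = member , unit-* (unit-^ unit-h (2 * j)) (unit-small c>0 c<P)
        where
        c>0 : 0 < c
        c>0 = proj₁ rep-c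
        c<P : c < P
        c<P = proj₁ (proj₂ rep-c)
        member : h ^ (2 * j) * c ∈ differences
        member = ∈-cartesianProductWith⁺ (λ c j → h ^ (2 * j) * c) (rep∈reps rep-c)
                                         (∈-upTo⁺ (*-cancelˡ-< 2 j K (<-≤-trans 2j<L L≤2K)))

      even-term : ∀ {c} → Rep c → ∀ b j → 2 * j < L → Covered (sign b * h ^ (2 * j) * c)
      even-term {c} rep-c b j 2j<L with member , unit-d ← difference j rep-c 2j<L =
        d , member , unit-d , 1 , s≤s z≤n , b , ≈-reflexive (begin
          sign b * h ^ (2 * j) * c  ≡⟨ *-assoc (sign b) (h ^ (2 * j)) c ⟩
          sign b * d                ≡⟨ cong (sign b *_) (*-identityˡ d) ⟨
          sign b * (1 * d)          ∎)
        where
        open ≡-Reasoning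
        d : ℕ
        d = h ^ (2 * j) * c

      -- ±h ^ (2j + 1) · c = ±2 · d for the difference d = h ^ (2j) · c, as h ≈ ±2.
      odd-term : ∀ {c} → Rep c → ∀ b j → suc (2 * j) < L → Covered (sign b * h ^ suc (2 * j) * c)
      odd-term {c} rep-c b j 2j+1<L with member , unit-d ← difference j rep-c (<-trans (n<1+n (2 * j)) 2j+1<L) =
        d , member , unit-d , 2 , ≤-refl , b xor s , (begin
          sign b * (h * h ^ (2 * j)) * c             ≈⟨ *-congʳ c (*-congˡ (sign b) (*-congʳ (h ^ (2 * j)) h≈±2)) ⟩
          sign b * (sign s * 2 * h ^ (2 * j)) * c    ≡⟨ regroup (sign b) (sign s) (h ^ (2 * j)) c ⟩
          sign b * sign s * (2 * d)                  ≈⟨ *-congʳ (2 * d) (sign-xor b s) ⟩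
          sign (b xor s) * (2 * d)                   ∎)
        where
        open ≈-Reasoning
        d : ℕ
        d = h ^ (2 * j) * c
        regroup : ∀ u v x y → u * (v * 2 * x) * y ≡ u * v * (2 * (x * y))
        regroup = solve-∀

      signed-power-covered : ∀ {c} → Rep c → ∀ b f → f < L → Covered (sign b * h ^ f * c)
      signed-power-covered {c} rep-c b f f<L = by-parity (parity f)
        where
        by-parity : (Σ ℕ λ j → (f ≡ 2 * j) ⊎ (f ≡ suc (2 * j))) → Covered (sign b * h ^ f * c)
        by-parity (j , inj₁ f≡2j) = subst (λ m → Covered (sign b * h ^ m * c)) (sym f≡2j)
                                          (even-term rep-c b j (subst (_< L) f≡2j f<L))
        by-parity (j , inj₂ f≡2j+1) = subst (λ m → Covered (sign b * h ^ m * c)) (sym f≡2j+1)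
                                            (odd-term rep-c b j (subst (_< L) f≡2j+1 f<L))

      -- Every nonzero residue is h ^ e · c for a representative c, hence ±h ^ f · c with f < L.
      covers : Covers 2 differences
      covers r r>0 r<P = from-rep (rep-exists r r>0 r<P)
        where
        from-rep : (Σ ℕ λ c → Rep c × Orbit r c) → Covered r
        from-rep (c , rep-c , e , r≈) = from-turn (half-turn (e % (2 * L)) (m%n<n e (2 * L)))
          where
          from-turn : (Σ Bool λ b → Σ ℕ λ f → f < L × h ^ (e % (2 * L)) ≈ sign b * h ^ f) → Covered r
          from-turn (b , f , f<L , h^e≈) = covered-resp (begin
            r                       ≈⟨ r≈ ⟩
            h ^ e * c               ≈⟨ *-congʳ c (power-mod e) ⟩
            h ^ (e % (2 * L)) * c   ≈⟨ *-congʳ c h^e≈ ⟩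
            sign b * h ^ f * c      ∎) (signed-power-covered rep-c b f f<L)
            where open ≈-Reasoning

      bound : Σ ℕ λ N → N * (2 * L) ≤ q × fLe 2 P (suc (N * K * (q + 2)))
      bound = length reps , orbit-count , sequence , chain-radius 2 differences covers , ≤-reflexive length-sequence
        where
        sequence : List (Fin P)
        sequence = map toFin (chain (q + 2) 0 differences)
        length-sequence : length sequence ≡ suc (length reps * K * (q + 2))
        length-sequence = begin
          length sequence                                  ≡⟨ length-map toFin (chain (q + 2) 0 differences) ⟩
          length (chain (q + 2) 0 differences)             ≡⟨ length-chain (q + 2) 0 differences ⟩
          suc (length differences * (q + 2))               ≡⟨ cong (λ m → suc (m * (q + 2))) count ⟩
          suc (length reps * K * (q + 2))                  ∎
          where
          open ≡-Reasoning
          count : length differences ≡ length reps * K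
          count = trans (length-cartesianProductWith _ reps (upTo K)) (cong (length reps *_) (length-upTo K))

    bound-with : ∀ K → L ≤ 2 * K → ∀ x y → 4 * K * x ≤ 2 * L * y → BoundWith x y
    bound-with K L≤2K x y 4Kx≤2Ly = conclude (Differences.bound K L≤2K)
      where
      conclude : (Σ ℕ λ N → N * (2 * L) ≤ q × fLe 2 P (suc (N * K * (q + 2)))) → BoundWith x y
      conclude (N , orbits≤q , fle) =
        suc (N * K * (q + 2)) , fle , length-estimate N K L q x y orbits≤q 4Kx≤2Ly

  module OrderOfTwo (ℓ : ℕ) (order₂ : IsMultOrder 2 P ℓ) where

    private
      ℓ≥1 : 1 ≤ ℓ
      ℓ≥1 = proj₁ order₂

      2^ℓ≈1 : 2 ^ ℓ ≈ 1
      2^ℓ≈1 = mk≈ (proj₁ (proj₂ order₂))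

      double-positive : ∀ {d} → 0 < d → 0 < 2 * d
      double-positive {d} d>0 = ≤-trans d>0 (m≤m+n d (d + 0))

    below-order : ∀ m → m < ℓ → 2 ^ m ≈ 1 → m ≡ 0
    below-order zero    _   _      = refl
    below-order (suc m) m<ℓ 2^m≈1 = ⊥-elim (<⇒≱ m<ℓ (proj₂ (proj₂ order₂) (suc m) (s≤s z≤n) (residues 2^m≈1)))

    -- ℓ odd: h = -2 satisfies h ^ ℓ ≈ -1, and h ^ (2d) ≈ 4 ^ d ≉ 1 for 0 < d < ℓ.
    odd-data : ∀ j → ℓ ≡ suc (2 * j) →
               (q * 2) ^ ℓ ≈ q × (∀ d → 0 < d → d < ℓ → ¬ (q * 2) ^ (2 * d) ≈ 1)
    odd-data j ℓ-odd = half , no-root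
      where
      half : (q * 2) ^ ℓ ≈ q
      half = begin
        (q * 2) ^ ℓ            ≡⟨ ^-distribʳ-* q 2 ℓ ⟩
        q ^ ℓ * 2 ^ ℓ          ≈⟨ *-congˡ (q ^ ℓ) 2^ℓ≈1 ⟩
        q ^ ℓ * 1              ≡⟨ trans (*-identityʳ (q ^ ℓ)) (cong (q ^_) ℓ-odd) ⟩
        q * q ^ (2 * j)        ≈⟨ *-congˡ q (even-power-of-involution q*q≈1 j) ⟩
        q * 1                  ≡⟨ *-identityʳ q ⟩
        q                      ∎
        where open ≈-Reasoning
      -- 2 ^ (2d) ≈ 1 forces 2d = ℓ, which is odd.
      no-root : ∀ d → 0 < d → d < ℓ → ¬ (q * 2) ^ (2 * d) ≈ 1
      no-root d d>0 d<ℓ h^2d≈1 = decide (2 * d <? ℓ)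
        where
        2^2d≈1 : 2 ^ (2 * d) ≈ 1
        2^2d≈1 = begin
          2 ^ (2 * d)                ≡⟨ *-identityˡ (2 ^ (2 * d)) ⟨
          1 * 2 ^ (2 * d)            ≈⟨ *-congʳ (2 ^ (2 * d)) (even-power-of-involution q*q≈1 d) ⟨
          q ^ (2 * d) * 2 ^ (2 * d)  ≡⟨ ^-distribʳ-* q 2 (2 * d) ⟨
          (q * 2) ^ (2 * d)          ≈⟨ h^2d≈1 ⟩
          1                          ∎
          where open ≈-Reasoning
        decide : Dec (2 * d < ℓ) → ⊥
        decide (yes 2d<ℓ) = <⇒≢ (double-positive d>0) (sym (below-order (2 * d) 2d<ℓ 2^2d≈1))
        decide (no 2d≮ℓ) = even≢odd d j (trans 2d≡ℓ ℓ-odd)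
          where
          ℓ≤2d : ℓ ≤ 2 * d
          ℓ≤2d = ≮⇒≥ 2d≮ℓ
          excess : ℕ
          excess = 2 * d ∸ ℓ
          2^excess≈1 : 2 ^ excess ≈ 1
          2^excess≈1 = begin
            2 ^ excess              ≡⟨ *-identityˡ (2 ^ excess) ⟨
            1 * 2 ^ excess          ≈⟨ *-congʳ (2 ^ excess) 2^ℓ≈1 ⟨
            2 ^ ℓ * 2 ^ excess      ≡⟨ ^-distribˡ-+-* 2 ℓ excess ⟨
            2 ^ (ℓ + excess)        ≡⟨ cong (2 ^_) (m+[n∸m]≡n ℓ≤2d) ⟩
            2 ^ (2 * d)             ≈⟨ 2^2d≈1 ⟩
            1                       ∎
            where open ≈-Reasoning
          excess≡0 : excess ≡ 0
          excess≡0 = below-order excess (∸-below-double ℓ≤2d (*-monoʳ-< 2 d<ℓ)) 2^excess≈1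
          2d≡ℓ : 2 * d ≡ ℓ
          2d≡ℓ = trans (sym (m+[n∸m]≡n ℓ≤2d)) (trans (cong (ℓ +_) excess≡0) (+-identityʳ ℓ))

    -- ℓ = 2L: h = 2 satisfies h ^ L ≈ -1 (a square root of 1 other than 1), and
    -- 2 ^ (2d) ≉ 1 for 0 < d < L since 2d < ℓ.
    even-data : ∀ L → ℓ ≡ 2 * L → 2 ^ L ≈ q × (∀ d → 0 < d → d < L → ¬ 2 ^ (2 * d) ≈ 1)
    even-data L ℓ-even = half (square-root-of-1 2^L-squared) , no-root
      where
      L>0 : 0 < L
      L>0 = n≢0⇒n>0 (λ L≡0 → <⇒≢ ℓ≥1 (sym (trans ℓ-even (cong (2 *_) L≡0))))
      2^L-squared : 2 ^ L * 2 ^ L ≈ 1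
      2^L-squared = ≈-trans (≈-reflexive (trans (sym (^-double 2 L)) (cong (2 ^_) (sym ℓ-even)))) 2^ℓ≈1
      half : (2 ^ L ≈ 1) ⊎ (2 ^ L ≈ q) → 2 ^ L ≈ q
      half (inj₁ 2^L≈1) = ⊥-elim (<⇒≢ L>0 (sym (below-order L L<ℓ 2^L≈1)))
        where
        L<ℓ : L < ℓ
        L<ℓ = subst (L <_) (sym ℓ-even) (m<m+n L (≤-trans L>0 (m≤m+n L 0)))
      half (inj₂ 2^L≈-1) = 2^L≈-1
      no-root : ∀ d → 0 < d → d < L → ¬ 2 ^ (2 * d) ≈ 1
      no-root d d>0 d<L 2^2d≈1 = <⇒≢ (double-positive d>0)
        (sym (below-order (2 * d) (subst (2 * d <_) (sym ℓ-even) (*-monoʳ-< 2 d<L)) 2^2d≈1))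

    -- ℓ odd: h = -2, L = ℓ and K = (ℓ + 1)/2.
    bound-odd : ℓ % 2 ≡ 1 → BoundWith ℓ (ℓ + 1)
    bound-odd ℓ%2≡1 = from-parity (parity ℓ)
      where
      from-parity : (Σ ℕ λ j → (ℓ ≡ 2 * j) ⊎ (ℓ ≡ suc (2 * j))) → BoundWith ℓ (ℓ + 1)
      from-parity (j , inj₁ ℓ-even) =
        ⊥-elim (0≢1+n (trans (sym (m*n%n≡0 j 2)) (trans (cong (_% 2) (trans (*-comm j 2) (sym ℓ-even))) ℓ%2≡1)))
      from-parity (j , inj₂ ℓ-odd) =
        Covering.bound-with (q * 2) ℓ true ≈-refl (proj₁ (odd-data j ℓ-odd)) (proj₂ (odd-data j ℓ-odd))
          (suc j) ℓ≤2K ℓ (ℓ + 1) (subst (λ m → 4 * suc j * m ≤ 2 * m * (m + 1)) (sym ℓ-odd) (≤-reflexive (identity j)))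
        where
        ℓ≤2K : ℓ ≤ 2 * suc j
        ℓ≤2K = subst (_≤ 2 * suc j) (sym ℓ-odd) (odd≤next-even j)
        identity : ∀ j → 4 * suc j * suc (2 * j) ≡ 2 * suc (2 * j) * (suc (2 * j) + 1)
        identity = solve-∀

    halve : ∀ {r} → ℓ % 4 ≡ 2 * r → ℓ ≡ 2 * (2 * (ℓ / 4) + r)
    halve {r} ℓ%4≡2r = begin
      ℓ                        ≡⟨ m≡m%n+[m/n]*n ℓ 4 ⟩
      ℓ % 4 + ℓ / 4 * 4        ≡⟨ cong (_+ ℓ / 4 * 4) ℓ%4≡2r ⟩
      2 * r + ℓ / 4 * 4        ≡⟨ regroup r (ℓ / 4) ⟩
      2 * (2 * (ℓ / 4) + r)    ∎
      where
      open ≡-Reasoning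
      regroup : ∀ r Q → 2 * r + Q * 4 ≡ 2 * (2 * Q + r)
      regroup = solve-∀

    -- ℓ ≡ 2 (mod 4): h = 2, L = ℓ/2 (odd) and K = (L + 1)/2.
    bound-2-mod-4 : ℓ % 4 ≡ 2 → BoundWith ℓ (ℓ + 2)
    bound-2-mod-4 ℓ%4≡2 =
      Covering.bound-with 2 L false ≈-refl (proj₁ (even-data L ℓ≡2L)) (proj₂ (even-data L ℓ≡2L))
        (suc Q) L≤2K ℓ (ℓ + 2) (subst (λ m → 4 * suc Q * m ≤ 2 * L * (m + 2)) (sym ℓ≡2L) (≤-reflexive (identity Q)))
      where
      Q L : ℕ
      Q = ℓ / 4
      L = 2 * Q + 1
      ℓ≡2L : ℓ ≡ 2 * L
      ℓ≡2L = halve ℓ%4≡2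
      L≤2K : L ≤ 2 * suc Q
      L≤2K = subst (_≤ 2 * suc Q) (+-comm 1 (2 * Q)) (odd≤next-even Q)
      identity : ∀ Q → 4 * suc Q * (2 * (2 * Q + 1)) ≡ 2 * (2 * Q + 1) * (2 * (2 * Q + 1) + 2)
      identity = solve-∀

    -- ℓ ≡ 0 (mod 4): h = 2, L = ℓ/2 (even) and K = L/2.
    bound-0-mod-4 : ℓ % 4 ≡ 0 → Σ ℕ λ B → fLe 2 P B × (4 * B ≤ (P + 1) * q + 4)
    bound-0-mod-4 ℓ%4≡0 = drop-unit
      (Covering.bound-with 2 L false ≈-refl (proj₁ (even-data L ℓ≡2L)) (proj₂ (even-data L ℓ≡2L))
        Q (≤-reflexive (+-identityʳ (2 * Q))) 1 1 (≤-reflexive (identity Q)))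
      where
      Q L : ℕ
      Q = ℓ / 4
      L = 2 * Q + 0
      ℓ≡2L : ℓ ≡ 2 * L
      ℓ≡2L = halve ℓ%4≡0
      identity : ∀ Q → 4 * Q * 1 ≡ 2 * (2 * Q + 0) * 1
      identity = solve-∀
      drop-unit : BoundWith 1 1 → Σ ℕ λ B → fLe 2 P B × (4 * B ≤ (P + 1) * q + 4)
      drop-unit (B , fle , ineq) = B , fle , subst (4 * B ≤_) (cong (_+ 4) (*-identityʳ ((P + 1) * q))) ineq

theorem4p1 : (p : ℕ) → Prime p → p % 2 ≡ 1 → (ℓ : ℕ) → IsMultOrder 2 (suc (p ∸ 1)) ℓ →
    (ℓ % 2 ≡ 1 → Σ ℕ λ B → fLe 2 p B × (4 * ℓ * B ≤ (p + 1) * (p ∸ 1) * (ℓ + 1) + 4 * ℓ)) ×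
    (ℓ % 4 ≡ 2 → Σ ℕ λ B → fLe 2 p B × (4 * ℓ * B ≤ (p + 1) * (p ∸ 1) * (ℓ + 2) + 4 * ℓ)) ×
    (ℓ % 4 ≡ 0 → Σ ℕ λ B → fLe 2 p B × (4 * B ≤ (p + 1) * (p ∸ 1) + 4))
theorem4p1 0 p-prime _ _ _ = ⊥-elim (¬prime[0] p-prime)
theorem4p1 1 p-prime _ _ _ = ⊥-elim (¬prime[1] p-prime)
theorem4p1 2 _ () _ _
theorem4p1 (suc q@(suc (suc _))) p-prime _ ℓ order₂ = bound-odd , bound-2-mod-4 , bound-0-mod-4
  where open PrimeModulus.OrderOfTwo q (s≤s (s≤s z≤n)) p-prime ℓ order₂
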